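{- Let $G$ be a directed acyclic graph with vertex set $[n]$ whose edges $(i,j)$ all satisfy $i<j$, and let $H\subseteq G$ be a subgraph. Then $\tilde Q_H$ is a face of $\tilde Q_G$ if and only if the directed multigraph $H_{\mathrm{comp}}$ is loopless and acyclic.
   Context: For such a graph $G$, $\tilde Q_G=\mathrm{conv}\{\mathbf 0,\ \mathbf e_i-\mathbf e_j : (i,j)\in E(G)\}\subset\mathbb R^n$, where $\mathbf e_i$ is the $i$-th standard basis vector. A subgraph $H\subseteq G$ means $V(H)=V(G)$ and $E(H)\subseteq E(G)$. $H^{\mathrm{un}}$ denotes the underlying undirected graph of $H$. The directed multigraph $H_{\mathrm{comp}}$ has as vertices the connected components of $H^{\mathrm{un}}$, and for each edge $(v,w)\in E(G)\setminus E(H)$ it has one edge from the component containing $v$ to the component containing $w$ (so it may have multiple edges and loops). "Acyclic" means having no directed cycle.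
   Formalization: The polytopes $\tilde Q_G$ and $\tilde Q_H$ are taken in ℚ^n rather than ℝ^n, as rational convex combinations, and the supporting hyperplanes cutting out faces have rational coefficients. -}

module Defs where

open import Data.Nat using (ℕ; zero; suc)
open import Data.Fin using (Fin; zero; suc; _≟_)
open import Data.Bool using (Bool; true; false; if_then_else_)
open import Data.Rational using (ℚ; 0ℚ; 1ℚ; _+_; _*_; _-_; _≤_)
open import Data.Product using (Σ; ∃; _×_; _,_)
open import Data.Sum using (_⊎_)
open import Relation.Nullary using (¬_)
open import Relation.Nullary.Decidable using (⌊_⌋)
open import Relation.Binary.PropositionalEquality using (_≡_)
open import Relation.Binary.Construct.Closure.ReflexiveTransitive using (Star)
open import Relation.Binary.Construct.Closure.Transitive using (TransClosure)

Digraph : ℕ → Set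
Digraph n = Fin n → Fin n → Bool

Point : ℕ → Set
Point n = Fin n → ℚ

Σℚ : ∀ {k} → (Fin k → ℚ) → ℚ
Σℚ {zero}  f = 0ℚ
Σℚ {suc k} f = f zero + Σℚ (λ t → f (suc t))

dot : ∀ {n} → Point n → Point n → ℚ
dot c x = Σℚ (λ r → c r * x r)

0v : ∀ {n} → Point n
0v _ = 0ℚ

e : ∀ {n} → Fin n → Point n
e i k = if ⌊ k ≟ i ⌋ then 1ℚ else 0ℚ

_−v_ : ∀ {n} → Point n → Point n → Point n
(x −v y) k = x k - y k

PSet : ℕ → Set₁
PSet n = Point n → Set

Conv : ∀ {n} → PSet n → PSet n
Conv {n} S x =
  Σ ℕ λ k → Σ (Fin k → ℚ) λ λs → Σ (Fin k → Point n) λ p →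
    (∀ t → S (p t)) × (∀ t → 0ℚ ≤ λs t) × (Σℚ λs ≡ 1ℚ) ×
    (∀ r → x r ≡ Σℚ (λ t → λs t * p t r))

-- The generating points {0} ∪ {e_i − e_j : (i,j) ∈ E(G)}  (points compared coordinatewise).
GenPts : ∀ {n} → Digraph n → PSet n
GenPts {n} G x =
  (∀ r → x r ≡ 0v r) ⊎
  (Σ (Fin n) λ i → Σ (Fin n) λ j → (G i j ≡ true) × (∀ r → x r ≡ (e i −v e j) r))

Q̃ : ∀ {n} → Digraph n → PSet n
Q̃ G = Conv (GenPts G)

IsFace : ∀ {n} → PSet n → PSet n → Set
IsFace {n} F P =
  Σ (Point n) λ c → Σ ℚ λ m →
    (∀ x → P x → dot c x ≤ m) ×
    (∀ x → (F x → (P x × dot c x ≡ m)) × ((P x × dot c x ≡ m) → F x))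

_⊆G_ : ∀ {n} → Digraph n → Digraph n → Set
H ⊆G G = ∀ i j → H i j ≡ true → G i j ≡ true

UAdj : ∀ {n} → Digraph n → Fin n → Fin n → Set
UAdj H v w = (H v w ≡ true) ⊎ (H w v ≡ true)

SameComp : ∀ {n} → Digraph n → Fin n → Fin n → Set
SameComp H = Star (UAdj H)

-- (a , b) ∈ E(G) ∖ E(H): these index the edges of H_comp.
OutEdge : ∀ {n} → Digraph n → Digraph n → Fin n → Fin n → Set
OutEdge G H a b = (G a b ≡ true) × (H a b ≡ false)

-- H_comp is loopless: no edge of E(G)∖E(H) joins two vertices of the same component.
CompLoopless : ∀ {n} → Digraph n → Digraph n → Set
CompLoopless G H = ∀ a b → OutEdge G H a b → ¬ SameComp H a b

-- One step in H_comp, lifted to vertices: from (the component of) v to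
-- (the component of) w along an edge (a,b) ∈ E(G)∖E(H) with a ~ v, b ~ w.
CompStep : ∀ {n} → Digraph n → Digraph n → Fin n → Fin n → Set
CompStep {n} G H v w =
  Σ (Fin n) λ a → Σ (Fin n) λ b → SameComp H v a × OutEdge G H a b × SameComp H b w

CompAcyclic : ∀ {n} → Digraph n → Digraph n → Set
CompAcyclic {n} G H = ¬ (Σ (Fin n) λ v → TransClosure (CompStep G H) v v)

module Submission where

-- Both conditions of the theorem are equivalent to the existence of a
-- *potential* for (G , H): a vector c ∈ ℚⁿ that is constant along the edges
-- of H and strictly increasing along the edges of E(G) ∖ E(H).
--
--  * A supporting functional c of a face Q̃_H is such a potential: the face
--    contains 0 and every e_a − e_b with (a,b) ∈ E(H), so c is flat on H;
--    an edge of E(G) ∖ E(H) with c_a = c_b would put the vertex e_a − e_b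
--    of Q̃_G into Q̃_H, which the functional e_a − e_b rules out.
--  * Conversely a potential c supports Q̃_H: c·x ≤ 0 on Q̃_G, and a convex
--    combination with c·x = 0 puts no weight on generators outside H.
--  * A potential is constant on components of H and rises along H_comp,
--    so H_comp is loopless and acyclic.
--  * If H_comp is acyclic, a potential is given by longest-walk lengths in
--    H_comp; these are computed as a fixpoint of a relaxation iteration
--    whose values stay bounded because, by the pigeonhole principle, walks
--    in an acyclic relation on Fin n are shorter than n.

open import Defs

module RationalSums where

  open import Data.Nat using (zero; suc)
  open import Data.Fin using (Fin; zero; suc)
  open import Data.Rational using (ℚ; 0ℚ; 1ℚ; _+_; _*_; _-_; -_; _≤_; _<_; positive)
  open import Data.Rational.Properties
  open import Data.Rational.Solver using (module +-*-Solver)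
  open import Data.Empty using (⊥-elim)
  open import Relation.Binary.Definitions using (tri<; tri≈; tri>)
  open import Relation.Binary.PropositionalEquality
  open +-*-Solver using (solve; _:+_; _:*_; _:=_)

  ≤∧≢⇒< : ∀ {p q} → p ≤ q → p ≢ q → p < q
  ≤∧≢⇒< {p} {q} p≤q p≢q with <-cmp p q
  ... | tri< p<q _ _ = p<q
  ... | tri≈ _ p≡q _ = ⊥-elim (p≢q p≡q)
  ... | tri> _ _ p>q = ⊥-elim (<-irrefl refl (<-≤-trans p>q p≤q))

  weight-vanishes : ∀ {l q} → 0ℚ ≤ l → q < 0ℚ → l * q ≡ 0ℚ → l ≡ 0ℚ
  weight-vanishes {l} {q} 0≤l q<0 lq≡0 with <-cmp 0ℚ l
  ... | tri< 0<l _ _ = ⊥-elim (<-irrefl lq≡0 (subst (l * q <_) (*-zeroʳ l) (*-monoʳ-<-pos l {{positive 0<l}} q<0)))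
  ... | tri≈ _ 0≡l _ = sym 0≡l
  ... | tri> _ _ l<0 = ⊥-elim (<-irrefl refl (<-≤-trans l<0 0≤l))

  p≤q⇒p-q≤0 : ∀ {p q} → p ≤ q → p - q ≤ 0ℚ
  p≤q⇒p-q≤0 {p} {q} le = subst (p - q ≤_) (+-inverseʳ q) (+-monoˡ-≤ (- q) le)

  p<q⇒p-q<0 : ∀ {p q} → p < q → p - q < 0ℚ
  p<q⇒p-q<0 {p} {q} lt = subst (p - q <_) (+-inverseʳ q) (+-monoˡ-< (- q) lt)

  p≡q⇒p-q≡0 : ∀ {p q} → p ≡ q → p - q ≡ 0ℚ
  p≡q⇒p-q≡0 {p} refl = +-inverseʳ p

  p-q+q≡p : ∀ p q → (p - q) + q ≡ p
  p-q+q≡p p q = trans (+-assoc p (- q) q) (trans (cong (p +_) (+-inverseˡ q)) (+-identityʳ p))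

  p-q≡0⇒p≡q : ∀ {p q} → p - q ≡ 0ℚ → p ≡ q
  p-q≡0⇒p≡q {p} {q} eq = trans (sym (p-q+q≡p p q)) (trans (cong (_+ q) eq) (+-identityˡ q))

  p-q≤0⇒p≤q : ∀ {p q} → p - q ≤ 0ℚ → p ≤ q
  p-q≤0⇒p≤q {p} {q} le = subst₂ _≤_ (p-q+q≡p p q) (+-identityˡ q) (+-monoˡ-≤ q le)

  -Mono-≤ : ∀ {p q u v} → p ≤ u → v ≤ q → p - q ≤ u - v
  -Mono-≤ p≤u v≤q = +-mono-≤ p≤u (neg-antimono-≤ v≤q)

  Σ-cong : ∀ {k} {f g : Fin k → ℚ} → (∀ t → f t ≡ g t) → Σℚ f ≡ Σℚ g
  Σ-cong {zero}  eq = refl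
  Σ-cong {suc k} eq = cong₂ _+_ (eq zero) (Σ-cong (λ t → eq (suc t)))

  Σ-zero : ∀ {k} → Σℚ {k} (λ _ → 0ℚ) ≡ 0ℚ
  Σ-zero {zero}  = refl
  Σ-zero {suc k} = cong (0ℚ +_) (Σ-zero {k})

  Σ-+ : ∀ {k} (f g : Fin k → ℚ) → Σℚ (λ t → f t + g t) ≡ Σℚ f + Σℚ g
  Σ-+ {zero}  f g = refl
  Σ-+ {suc k} f g =
    trans (cong (f zero + g zero +_) (Σ-+ (λ t → f (suc t)) (λ t → g (suc t))))
          (interchange (f zero) (g zero) (Σℚ (λ t → f (suc t))) (Σℚ (λ t → g (suc t))))
    where
    interchange : ∀ a b c d → (a + b) + (c + d) ≡ (a + c) + (b + d)
    interchange = solve 4 (λ a b c d → (a :+ b) :+ (c :+ d) := (a :+ c) :+ (b :+ d)) refl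

  Σ-neg : ∀ {k} (f : Fin k → ℚ) → Σℚ (λ t → - f t) ≡ - Σℚ f
  Σ-neg {zero}  f = refl
  Σ-neg {suc k} f =
    trans (cong (- f zero +_) (Σ-neg (λ t → f (suc t)))) (sym (neg-distrib-+ (f zero) _))

  Σ-*ˡ : ∀ {k} a (f : Fin k → ℚ) → Σℚ (λ t → a * f t) ≡ a * Σℚ f
  Σ-*ˡ {zero}  a f = sym (*-zeroʳ a)
  Σ-*ˡ {suc k} a f =
    trans (cong (a * f zero +_) (Σ-*ˡ a (λ t → f (suc t)))) (sym (*-distribˡ-+ a (f zero) _))

  Σ-swap : ∀ {k l} (f : Fin k → Fin l → ℚ) →
           Σℚ (λ r → Σℚ (λ t → f r t)) ≡ Σℚ (λ t → Σℚ (λ r → f r t))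
  Σ-swap {zero}  {l} f = sym (Σ-zero {l})
  Σ-swap {suc k} {l} f =
    trans (cong (Σℚ (f zero) +_) (Σ-swap (λ r → f (suc r))))
          (sym (Σ-+ (f zero) (λ t → Σℚ (λ r → f (suc r) t))))

  Σ-mono : ∀ {k} {f g : Fin k → ℚ} → (∀ t → f t ≤ g t) → Σℚ f ≤ Σℚ g
  Σ-mono {zero}  le = ≤-refl
  Σ-mono {suc k} le = +-mono-≤ (le zero) (Σ-mono (λ t → le (suc t)))

  Σ-nonPos : ∀ {k} {f : Fin k → ℚ} → (∀ t → f t ≤ 0ℚ) → Σℚ f ≤ 0ℚ
  Σ-nonPos {k} {f} le = subst (Σℚ f ≤_) (Σ-zero {k}) (Σ-mono le)

  Σ-nonPos-zero : ∀ {k} (f : Fin k → ℚ) → (∀ t → f t ≤ 0ℚ) → Σℚ f ≡ 0ℚ → ∀ t → f t ≡ 0ℚ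
  Σ-nonPos-zero f le sum≡0 zero = ≤-antisym (le zero)
    (subst₂ _≤_ sum≡0 (+-identityʳ (f zero)) (+-monoʳ-≤ (f zero) (Σ-nonPos (λ t → le (suc t)))))
  Σ-nonPos-zero f le sum≡0 (suc t) = Σ-nonPos-zero (λ t → f (suc t)) (λ t → le (suc t)) tail≡0 t
    where
    tail : ℚ
    tail = Σℚ (λ t → f (suc t))
    tail≡0 : tail ≡ 0ℚ
    tail≡0 = ≤-antisym (Σ-nonPos (λ t → le (suc t)))
      (subst₂ _≤_ sum≡0 (+-identityˡ tail) (+-monoˡ-≤ tail (le zero)))

  Σ-weights : ∀ {k} (λs : Fin k → ℚ) (M : ℚ) → Σℚ λs ≡ 1ℚ → Σℚ (λ t → λs t * M) ≡ M
  Σ-weights λs M total =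
    trans (Σ-cong (λ t → *-comm (λs t) M))
          (trans (Σ-*ˡ M λs) (trans (cong (M *_) total) (*-identityʳ M)))

  *-exchange : ∀ a b c → a * (b * c) ≡ b * (a * c)
  *-exchange = solve 3 (λ a b c → a :* (b :* c) := b :* (a :* c)) refl


module Functionals where

  open import Data.Nat using (suc)
  open import Data.Fin using (Fin; zero; suc; _≟_)
  open import Data.Rational using (0ℚ; 1ℚ; _+_; _*_; _-_; -_; _≤_; _≤?_)
  open import Data.Rational.Properties hiding (_≟_)
  open import Data.Empty using (⊥-elim)
  open import Data.Unit using (tt)
  open import Relation.Nullary using (yes; no)
  open import Relation.Nullary.Decidable using (toWitness)
  open import Relation.Binary.PropositionalEquality
  open RationalSums

  0≤1 : 0ℚ ≤ 1ℚ
  0≤1 = toWitness {a? = 0ℚ ≤? 1ℚ} tt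

  e-self : ∀ {n} (a : Fin n) → e a a ≡ 1ℚ
  e-self a with a ≟ a
  ... | yes _ = refl
  ... | no a≢a = ⊥-elim (a≢a refl)

  e-other : ∀ {n} {a i : Fin n} → i ≢ a → e a i ≡ 0ℚ
  e-other {a = a} {i} i≢a with i ≟ a
  ... | yes i≡a = ⊥-elim (i≢a i≡a)
  ... | no _ = refl

  e-≤1 : ∀ {n} (a i : Fin n) → e a i ≤ 1ℚ
  e-≤1 a i with i ≟ a
  ... | yes _ = ≤-refl
  ... | no _ = 0≤1

  e-≥0 : ∀ {n} (a i : Fin n) → 0ℚ ≤ e a i
  e-≥0 a i with i ≟ a
  ... | yes _ = 0≤1
  ... | no _ = ≤-refl

  dot-e : ∀ {n} (c : Point n) (a : Fin n) → dot c (e a) ≡ c a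
  dot-e {suc n} c zero =
    trans (cong₂ _+_ (*-identityʳ (c zero)) (trans (Σ-cong (λ t → *-zeroʳ (c (suc t)))) (Σ-zero {n})))
          (+-identityʳ (c zero))
  dot-e {suc n} c (suc a) =
    trans (cong₂ _+_ (*-zeroʳ (c zero)) (trans (Σ-cong shift) (dot-e (λ t → c (suc t)) a)))
          (+-identityˡ (c (suc a)))
    where
    shift : ∀ t → c (suc t) * e (suc a) (suc t) ≡ c (suc t) * e a t
    shift t with t ≟ a
    ... | yes _ = refl
    ... | no _ = refl

  dot-cong : ∀ {n} (c : Point n) {x y : Point n} → (∀ r → x r ≡ y r) → dot c x ≡ dot c y
  dot-cong c eq = Σ-cong (λ r → cong (c r *_) (eq r))

  dot-0 : ∀ {n} (c : Point n) → dot c 0v ≡ 0ℚ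
  dot-0 {n} c = trans (Σ-cong (λ r → *-zeroʳ (c r))) (Σ-zero {n})

  dot-diff : ∀ {n} (c : Point n) (a b : Fin n) → dot c (e a −v e b) ≡ c a - c b
  dot-diff c a b =
    trans (Σ-cong (λ r → *-distribˡ-+ (c r) (e a r) (- e b r)))
          (trans (Σ-+ (λ r → c r * e a r) (λ r → c r * - e b r)) (cong₂ _+_ (dot-e c a) negated))
    where
    negated : Σℚ (λ r → c r * - e b r) ≡ - c b
    negated = trans (Σ-cong (λ r → sym (neg-distribʳ-* (c r) (e b r))))
                    (trans (Σ-neg (λ r → c r * e b r)) (cong -_ (dot-e c b)))

module ConvexHulls where

  open import Data.Fin using (Fin)
  open import Data.Rational using (ℚ; 1ℚ; _*_; _≤_; nonNegative)
  open import Data.Rational.Properties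
  open import Data.Product using (_,_)
  open import Data.Sum using (inj₁; inj₂)
  open import Data.Bool using (true)
  open import Relation.Binary.PropositionalEquality
  open RationalSums
  open Functionals

  dot-combination : ∀ {n k} (d x : Point n) (λs : Fin k → ℚ) (p : Fin k → Point n) →
                    (∀ r → x r ≡ Σℚ (λ t → λs t * p t r)) →
                    dot d x ≡ Σℚ (λ t → λs t * dot d (p t))
  dot-combination d x λs p x≡ =
    begin
      dot d x                                       ≡⟨ dot-cong d x≡ ⟩
      Σℚ (λ r → d r * Σℚ (λ t → λs t * p t r))      ≡⟨ Σ-cong (λ r → sym (Σ-*ˡ (d r) (λ t → λs t * p t r))) ⟩
      Σℚ (λ r → Σℚ (λ t → d r * (λs t * p t r)))    ≡⟨ Σ-swap (λ r t → d r * (λs t * p t r)) ⟩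
      Σℚ (λ t → Σℚ (λ r → d r * (λs t * p t r)))    ≡⟨ Σ-cong (λ t → Σ-cong (λ r → *-exchange (d r) (λs t) (p t r))) ⟩
      Σℚ (λ t → Σℚ (λ r → λs t * (d r * p t r)))    ≡⟨ Σ-cong (λ t → Σ-*ˡ (λs t) (λ r → d r * p t r)) ⟩
      Σℚ (λ t → λs t * dot d (p t))                 ∎
    where open ≡-Reasoning

  conv-≤ : ∀ {n} {S : PSet n} (d : Point n) (M : ℚ) → (∀ y → S y → dot d y ≤ M) →
           ∀ x → Conv S x → dot d x ≤ M
  conv-≤ d M bound x (k , λs , p , p∈S , nonNeg , total , x≡) =
    subst₂ _≤_ (sym (dot-combination d x λs p x≡)) (Σ-weights λs M total)
           (Σ-mono (λ t → *-monoˡ-≤-nonNeg (λs t) {{nonNegative (nonNeg t)}} (bound (p t) (p∈S t))))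

  conv-≡ : ∀ {n} {S : PSet n} (d : Point n) (M : ℚ) → (∀ y → S y → dot d y ≡ M) →
           ∀ x → Conv S x → dot d x ≡ M
  conv-≡ d M value x (k , λs , p , p∈S , nonNeg , total , x≡) =
    trans (dot-combination d x λs p x≡)
          (trans (Σ-cong (λ t → cong (λs t *_) (value (p t) (p∈S t)))) (Σ-weights λs M total))

  conv-mono : ∀ {n} {S T : PSet n} → (∀ y → S y → T y) → ∀ x → Conv S x → Conv T x
  conv-mono S⊆T x (k , λs , p , p∈S , rest) = k , λs , p , (λ t → S⊆T (p t) (p∈S t)) , rest

  ⊆conv : ∀ {n} {S : PSet n} (y : Point n) → S y → Conv S y
  ⊆conv y y∈S =
    1 , (λ _ → 1ℚ) , (λ _ → y) , (λ _ → y∈S) , (λ _ → 0≤1) , refl ,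
    λ r → sym (trans (+-identityʳ _) (*-identityˡ (y r)))

  origin∈Q̃ : ∀ {n} (G : Digraph n) → Q̃ G 0v
  origin∈Q̃ G = ⊆conv {S = GenPts G} 0v (inj₁ (λ _ → refl))

  edge∈Q̃ : ∀ {n} {G : Digraph n} {a b} → G a b ≡ true → Q̃ G (e a −v e b)
  edge∈Q̃ {G = G} {a} {b} g = ⊆conv {S = GenPts G} _ (inj₂ (a , b , g , λ _ → refl))

  generators-mono : ∀ {n} {G H : Digraph n} → H ⊆G G → ∀ y → GenPts H y → GenPts G y
  generators-mono sub y (inj₁ y≡0) = inj₁ y≡0
  generators-mono sub y (inj₂ (i , j , h , y≡eij)) = inj₂ (i , j , sub i j h , y≡eij)

module Potentials where

  open import Data.Fin using (_≟_)
  open import Data.Bool using (true; false; if_then_else_)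
  open import Data.Rational using (ℚ; 0ℚ; 1ℚ; _*_; _-_; _≤_; _<_; _≤?_; nonNegative)
  open import Data.Rational.Properties hiding (_≟_)
  open import Data.Product using (_,_; proj₁; proj₂)
  open import Data.Sum using (inj₁; inj₂)
  open import Data.Unit using (tt)
  open import Function using (_∘_)
  open import Relation.Nullary using (¬_; Dec; yes; no)
  open import Relation.Nullary.Decidable using (toWitness; toWitnessFalse)
  open import Relation.Binary.PropositionalEquality
  open import Relation.Binary.Construct.Closure.ReflexiveTransitive using (ε; _◅_)
  open import Relation.Binary.Construct.Closure.Transitive using (TransClosure; [_]; _∷_)
  open RationalSums
  open Functionals
  open ConvexHulls

  record Potential {n} (G H : Digraph n) : Set where
    field
      level  : Point n
      flat   : ∀ {a b} → H a b ≡ true → level a ≡ level b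
      rising : ∀ {a b} → OutEdge G H a b → level a < level b

  -- For a ≠ b and (a,b) ∉ E(H), the point e_a − e_b lies outside Q̃_H: the
  -- functional d = e_a − e_b is at most 1 on every generator of Q̃_H, but d·d = 2.
  diff∉Q̃ : ∀ {n} {H : Digraph n} {a b} → a ≢ b → H a b ≡ false → ¬ Q̃ H (e a −v e b)
  diff∉Q̃ {n} {H} {a} {b} a≢b ab∉H d∈Q̃ =
    toWitnessFalse {a? = (1ℚ - 0ℚ) - (0ℚ - 1ℚ) ≤? 1ℚ} tt
      (subst (_≤ 1ℚ) d·d (conv-≤ d 1ℚ atMostOne d d∈Q̃))
    where
    d : Point n
    d = e a −v e b
    d·d : dot d d ≡ (1ℚ - 0ℚ) - (0ℚ - 1ℚ)
    d·d = trans (dot-diff d a b)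
      (cong₂ _-_ (cong₂ _-_ (e-self a) (e-other a≢b)) (cong₂ _-_ (e-other (a≢b ∘ sym)) (e-self b)))
    -- d_i − d_j ≤ 1 unless (i , j) = (a , b), which is not an edge of H.
    edgeValue : ∀ {i j} → H i j ≡ true → d i - d j ≤ 1ℚ
    edgeValue {i} {j} ij∈H = byCase (i ≟ a)
      where
      byCase : Dec (i ≡ a) → d i - d j ≤ 1ℚ
      byCase (yes i≡a) = ≤-trans
        (-Mono-≤ (-Mono-≤ (e-≤1 a i) (e-≥0 b i)) (-Mono-≤ (e-≥0 a j) (≤-reflexive (e-other j≢b))))
        (toWitness {a? = (1ℚ - 0ℚ) - (0ℚ - 0ℚ) ≤? 1ℚ} tt)
        where
        j≢b : j ≢ b
        j≢b j≡b with trans (sym ij∈H) (subst₂ (λ x y → H x y ≡ false) (sym i≡a) (sym j≡b) ab∉H)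
        ... | ()
      byCase (no i≢a) = ≤-trans
        (-Mono-≤ (-Mono-≤ (≤-reflexive (e-other i≢a)) (e-≥0 b i)) (-Mono-≤ (e-≥0 a j) (e-≤1 b j)))
        (toWitness {a? = (0ℚ - 0ℚ) - (0ℚ - 1ℚ) ≤? 1ℚ} tt)
    atMostOne : ∀ y → GenPts H y → dot d y ≤ 1ℚ
    atMostOne y (inj₁ y≡0) = subst (_≤ 1ℚ) (sym (trans (dot-cong d y≡0) (dot-0 d))) 0≤1
    atMostOne y (inj₂ (i , j , ij∈H , y≡eij)) =
      subst (_≤ 1ℚ) (sym (trans (dot-cong d y≡eij) (dot-diff d i j))) (edgeValue ij∈H)

  face⇒potential : ∀ {n} {G H : Digraph n} → (∀ {a b} → G a b ≡ true → a ≢ b) →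
                   IsFace (Q̃ H) (Q̃ G) → Potential G H
  face⇒potential {G = G} {H} loopFree (c , m , below , onFace) =
    record { level = c ; flat = flat ; rising = rising }
    where
    valueOnFace : ∀ {x} → Q̃ H x → dot c x ≡ m
    valueOnFace x∈ = proj₂ (proj₁ (onFace _) x∈)
    m≡0 : m ≡ 0ℚ
    m≡0 = trans (sym (valueOnFace (origin∈Q̃ H))) (dot-0 c)
    flat : ∀ {a b} → H a b ≡ true → c a ≡ c b
    flat {a} {b} ab∈H =
      p-q≡0⇒p≡q (trans (sym (dot-diff c a b)) (trans (valueOnFace (edge∈Q̃ ab∈H)) m≡0))
    weak : ∀ {a b} → G a b ≡ true → c a ≤ c b
    weak {a} {b} ab∈G = p-q≤0⇒p≤q (subst₂ _≤_ (dot-diff c a b) m≡0 (below _ (edge∈Q̃ ab∈G)))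
    -- Equality c_a = c_b would put the vertex e_a − e_b of Q̃_G on the face Q̃_H.
    rising : ∀ {a b} → OutEdge G H a b → c a < c b
    rising {a} {b} (ab∈G , ab∉H) = ≤∧≢⇒< (weak ab∈G) λ ca≡cb →
      diff∉Q̃ (loopFree ab∈G) ab∉H (proj₂ (onFace _)
        (edge∈Q̃ ab∈G , trans (dot-diff c a b) (trans (p≡q⇒p-q≡0 ca≡cb) (sym m≡0))))

  module _ {n} {G H : Digraph n} (P : Potential G H) where
    open Potential P

    level-weak : ∀ {a b} → G a b ≡ true → level a ≤ level b
    level-weak {a} {b} ab∈G with H a b in ab∈H
    ... | true  = ≤-reflexive (flat ab∈H)
    ... | false = <⇒≤ (rising (ab∈G , ab∈H))

    nonPos-on-G : ∀ y → GenPts G y → dot level y ≤ 0ℚ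
    nonPos-on-G y (inj₁ y≡0) = ≤-reflexive (trans (dot-cong level y≡0) (dot-0 level))
    nonPos-on-G y (inj₂ (i , j , ij∈G , y≡eij)) =
      subst (_≤ 0ℚ) (sym (trans (dot-cong level y≡eij) (dot-diff level i j))) (p≤q⇒p-q≤0 (level-weak ij∈G))

    zero-on-H : ∀ y → GenPts H y → dot level y ≡ 0ℚ
    zero-on-H y (inj₁ y≡0) = trans (dot-cong level y≡0) (dot-0 level)
    zero-on-H y (inj₂ (i , j , ij∈H , y≡eij)) =
      trans (dot-cong level y≡eij) (trans (dot-diff level i j) (p≡q⇒p-q≡0 (flat ij∈H)))

    restrict : (y : Point n) → GenPts G y → Point n
    restrict y (inj₁ _) = y
    restrict y (inj₂ (i , j , _ , _)) = if H i j then y else 0v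

    restrict-generates : ∀ y y∈G → GenPts H (restrict y y∈G)
    restrict-generates y (inj₁ y≡0) = inj₁ y≡0
    restrict-generates y (inj₂ (i , j , ij∈G , y≡eij)) with H i j in ij∈H
    ... | true  = inj₂ (i , j , ij∈H , y≡eij)
    ... | false = inj₁ (λ _ → refl)

    -- Restricting does not change a term of weight l with l·(c·y) = 0, since
    -- c·y < 0 on the replaced generators forces l = 0.
    restrict-weighted : ∀ y y∈G (l : ℚ) → 0ℚ ≤ l → l * dot level y ≡ 0ℚ →
                        ∀ r → l * restrict y y∈G r ≡ l * y r
    restrict-weighted y (inj₁ _) l 0≤l term≡0 r = refl
    restrict-weighted y (inj₂ (i , j , ij∈G , y≡eij)) l 0≤l term≡0 r with H i j in ij∈H
    ... | true  = refl
    ... | false rewrite weight-vanishes 0≤l (p<q⇒p-q<0 (rising (ij∈G , ij∈H)))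
                          (trans (cong (l *_) (sym (trans (dot-cong level y≡eij) (dot-diff level i j)))) term≡0)
                = trans (*-zeroˡ 0ℚ) (sym (*-zeroˡ (y r)))

    -- A point of Q̃_G on which the potential vanishes lies in Q̃_H: every term of
    -- its convex combination vanishes, so restricting the generators keeps it.
    vanishing⇒Q̃H : ∀ x → Q̃ G x → dot level x ≡ 0ℚ → Q̃ H x
    vanishing⇒Q̃H x (k , λs , p , p∈G , nonNeg , total , x≡) cx≡0 =
      k , λs , (λ t → restrict (p t) (p∈G t)) , (λ t → restrict-generates (p t) (p∈G t)) , nonNeg , total ,
      λ r → trans (x≡ r) (Σ-cong (λ t → sym (restrict-weighted (p t) (p∈G t) (λs t) (nonNeg t) (termZero t) r)))
      where
      termNonPos : ∀ t → λs t * dot level (p t) ≤ 0ℚ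
      termNonPos t = subst (λs t * dot level (p t) ≤_) (*-zeroʳ (λs t))
        (*-monoˡ-≤-nonNeg (λs t) {{nonNegative (nonNeg t)}} (nonPos-on-G (p t) (p∈G t)))
      termZero : ∀ t → λs t * dot level (p t) ≡ 0ℚ
      termZero = Σ-nonPos-zero _ termNonPos (trans (sym (dot-combination level x λs p x≡)) cx≡0)

    level-component : ∀ {a b} → SameComp H a b → level a ≡ level b
    level-component ε = refl
    level-component (inj₁ ab∈H ◅ rest) = trans (flat ab∈H) (level-component rest)
    level-component (inj₂ ba∈H ◅ rest) = trans (sym (flat ba∈H)) (level-component rest)

    level-step : ∀ {v w} → CompStep G H v w → level v < level w
    level-step (a , b , v~a , out , b~w) =
      subst₂ _<_ (sym (level-component v~a)) (level-component b~w) (rising out)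

  potential⇒face : ∀ {n} {G H : Digraph n} → H ⊆G G → Potential G H → IsFace (Q̃ H) (Q̃ G)
  potential⇒face H⊆G P =
    level , 0ℚ , conv-≤ level 0ℚ (nonPos-on-G P) ,
    λ x → (λ x∈H → conv-mono (generators-mono H⊆G) x x∈H , conv-≡ level 0ℚ (zero-on-H P) x x∈H)
        , λ (x∈G , cx≡0) → vanishing⇒Q̃H P x x∈G cx≡0
    where open Potential P

  rises-along-closure : ∀ {A : Set} {R : A → A → Set} (f : A → ℚ) →
                        (∀ {x y} → R x y → f x < f y) → ∀ {x y} → TransClosure R x y → f x < f y
  rises-along-closure f rises [ r ]    = rises r
  rises-along-closure f rises (r ∷ rs) = <-trans (rises r) (rises-along-closure f rises rs)

  potential⇒loopless : ∀ {n} {G H : Digraph n} → Potential G H → CompLoopless G H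
  potential⇒loopless P a b out a~b = <-irrefl (level-component P a~b) (Potential.rising P out)

  potential⇒acyclic : ∀ {n} {G H : Digraph n} → Potential G H → CompAcyclic G H
  potential⇒acyclic P (v , cycle) = <-irrefl refl (rises-along-closure (Potential.level P) (level-step P) cycle)

module Walks where

  open import Data.Nat using (ℕ; zero; suc; _<_; _≤_; s≤s)
  open import Data.Nat.Properties using (≰⇒>; ≤-pred)
  open import Data.Fin using (Fin; toℕ)
  open import Data.Fin.Properties using (pigeonhole; toℕ<n)
  open import Data.Product using (_,_)
  open import Relation.Nullary using (¬_)
  open import Relation.Binary.PropositionalEquality using (subst)
  open import Relation.Binary.Construct.Closure.ReflexiveTransitive using (Star; ε; _◅_; _◅◅_)
  open import Relation.Binary.Construct.Closure.Transitive using (TransClosure; [_]; _∷_)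

  data Walk {A : Set} (R : A → A → Set) : ℕ → A → A → Set where
    []  : ∀ {v} → Walk R 0 v v
    _▷_ : ∀ {k u w v} → Walk R k u w → R w v → Walk R (suc k) u v

  module _ {A : Set} {R : A → A → Set} where

    -- The vertex i steps before the end of a walk (its start, once i exceeds the length).
    stepsBeforeEnd : ∀ {k u v} → Walk R k u v → ℕ → A
    stepsBeforeEnd {v = v} []      _       = v
    stepsBeforeEnd {v = v} (_ ▷ _) zero    = v
    stepsBeforeEnd         (p ▷ _) (suc i) = stepsBeforeEnd p i

    reaches-end : ∀ {k u v} (p : Walk R k u v) i → Star R (stepsBeforeEnd p i) v
    reaches-end []      i       = ε
    reaches-end (p ▷ s) zero    = ε
    reaches-end (p ▷ s) (suc i) = reaches-end p i ◅◅ (s ◅ ε)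

    star-then-step : ∀ {x y z} → Star R x y → R y z → TransClosure R x z
    star-then-step ε        s = [ s ]
    star-then-step (r ◅ rs) s = r ∷ star-then-step rs s

    segment : ∀ {k u v} (p : Walk R k u v) {i j} → i < j → j ≤ k →
              TransClosure R (stepsBeforeEnd p j) (stepsBeforeEnd p i)
    segment (p ▷ s) {zero}  {suc j} _         _         = star-then-step (reaches-end p j) s
    segment (p ▷ s) {suc i} {suc j} (s≤s i<j) (s≤s j≤k) = segment p i<j j≤k

  -- In a relation on Fin n without cycles, every walk has fewer than n steps:
  -- a walk with n or more steps visits some vertex twice.
  walk-shorter : ∀ {n} {R : Fin n → Fin n → Set} → (∀ v → ¬ TransClosure R v v) →
                 ∀ {k u v} → Walk R k u v → k < n
  walk-shorter {R = R} acyclic {k} p = ≰⇒> λ n≤k →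
    let (i , j , i<j , same) = pigeonhole (s≤s n≤k) (λ i → stepsBeforeEnd p (toℕ i))
    in acyclic _ (subst (TransClosure R _) same (segment p i<j (≤-pred (toℕ<n j))))

module LongestWalks where

  open import Data.Nat using (ℕ; zero; suc; _⊔_; _∸_; _+_; _≤_; _<_; _≟_; z≤n)
  open import Data.Nat.Properties
    using (≤-refl; ≤-trans; <-≤-trans; ≤-pred; ≤∧≢⇒<; ⊔-sel; m≤m⊔n; m≤n⊔m;
           +-mono-≤; +-mono-<-≤; +-mono-≤-<; ∸-monoʳ-≤; ∸-monoʳ-<)
  open import Data.Fin using (Fin; zero; suc)
  open import Data.Fin.Properties using (all?; ¬∀⟶∃¬)
  open import Data.Bool using (Bool; true; false)
  open import Data.Product using (Σ; _,_; proj₁; proj₂)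
  open import Data.Sum using (_⊎_; inj₁; inj₂)
  open import Function using (_∘_)
  open import Relation.Nullary using (yes; no)
  open import Relation.Binary.PropositionalEquality using (_≡_; sym; subst)

  onlyIf : Bool → ℕ → ℕ
  onlyIf true  k = k
  onlyIf false k = 0

  ⊔-ind : ∀ (P : ℕ → Set) {m k} → P m → P k → P (m ⊔ k)
  ⊔-ind P {m} {k} pm pk with ⊔-sel m k
  ... | inj₁ eq = subst P (sym eq) pm
  ... | inj₂ eq = subst P (sym eq) pk

  maxOver : ∀ {m} → (Fin m → ℕ) → ℕ
  maxOver {zero}  f = 0
  maxOver {suc m} f = f zero ⊔ maxOver (f ∘ suc)

  maxOver-ub : ∀ {m} (f : Fin m → ℕ) i → f i ≤ maxOver f
  maxOver-ub f zero    = m≤m⊔n _ _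
  maxOver-ub f (suc i) = ≤-trans (maxOver-ub (f ∘ suc) i) (m≤n⊔m (f zero) _)

  maxOver-ind : ∀ (P : ℕ → Set) {m} (f : Fin m → ℕ) → P 0 → (∀ i → P (f i)) → P (maxOver f)
  maxOver-ind P {zero}  f p0 pf = p0
  maxOver-ind P {suc m} f p0 pf = ⊔-ind P (pf zero) (maxOver-ind P (f ∘ suc) p0 (pf ∘ suc))

  sumOver : ∀ {m} → (Fin m → ℕ) → ℕ
  sumOver {zero}  f = 0
  sumOver {suc m} f = f zero + sumOver (f ∘ suc)

  sumOver-mono : ∀ {m} {f g : Fin m → ℕ} → (∀ i → f i ≤ g i) → sumOver f ≤ sumOver g
  sumOver-mono {zero}  le = z≤n
  sumOver-mono {suc m} le = +-mono-≤ (le zero) (sumOver-mono (le ∘ suc))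

  sumOver-strict : ∀ {m} {f g : Fin m → ℕ} → (∀ i → f i ≤ g i) → ∀ v → f v < g v → sumOver f < sumOver g
  sumOver-strict le zero    lt = +-mono-<-≤ lt (sumOver-mono (le ∘ suc))
  sumOver-strict le (suc v) lt = +-mono-≤-< (le zero) (sumOver-strict (le ∘ suc) v lt)

  -- Let Reach k v say that some walk of length k ends at v, for a notion of walk
  -- that can be extended along weak edges W (keeping its length) and strict
  -- edges S (adding one step), and whose length is bounded by B.  Then there is
  -- a labelling that weakly increases along W and strictly along S, found by
  -- raising labels to the lengths of ever longer walks until they are stable.
  module Labelling {n : ℕ} (W S : Fin n → Fin n → Bool) (Reach : ℕ → Fin n → Set) (B : ℕ)
      (reach-zero    : ∀ v → Reach 0 v)
      (reach-weak    : ∀ {k u v} → W u v ≡ true → Reach k u → Reach k v)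
      (reach-strict  : ∀ {k u v} → S u v ≡ true → Reach k u → Reach (suc k) v)
      (reach-bounded : ∀ {k v} → Reach k v → k ≤ B) where

    Labels : Set
    Labels = Fin n → ℕ

    demand : Labels → Fin n → Fin n → ℕ
    demand x v u = onlyIf (W u v) (x u) ⊔ onlyIf (S u v) (suc (x u))

    relax : Labels → Labels
    relax x v = x v ⊔ maxOver (demand x v)

    -- Every label is the length of a walk: relaxation preserves this, and it
    -- keeps all labels below B.
    Realised : Labels → Set
    Realised x = ∀ v → Reach (x v) v

    relax-realised : ∀ x → Realised x → Realised (relax x)
    relax-realised x realised v =
      ⊔-ind (λ k → Reach k v) (realised v) (maxOver-ind (λ k → Reach k v) (demand x v) (reach-zero v) met)
      where
      alongWeak : ∀ u → Reach (onlyIf (W u v) (x u)) v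
      alongWeak u with W u v in weak
      ... | true  = reach-weak weak (realised u)
      ... | false = reach-zero v
      alongStrict : ∀ u → Reach (onlyIf (S u v) (suc (x u))) v
      alongStrict u with S u v in strict
      ... | true  = reach-strict strict (realised u)
      ... | false = reach-zero v
      met : ∀ u → Reach (demand x v u) v
      met u = ⊔-ind (λ k → Reach k v) (alongWeak u) (alongStrict u)

    slack : Labels → ℕ
    slack x = sumOver (λ v → B ∸ x v)

    progress : ∀ x → Realised x → (∀ v → relax x v ≡ x v) ⊎ slack (relax x) < slack x
    progress x realised with all? (λ v → relax x v ≟ x v)
    ... | yes stable = inj₁ stable
    ... | no unstable with ¬∀⟶∃¬ n _ (λ v → relax x v ≟ x v) unstable
    ...   | v , moved = inj₂ (sumOver-strict (λ w → ∸-monoʳ-≤ B (grows w)) v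
                               (∸-monoʳ-< (≤∧≢⇒< (grows v) (moved ∘ sym))
                                          (reach-bounded (relax-realised x realised v))))
      where
      grows : ∀ w → x w ≤ relax x w
      grows w = m≤m⊔n (x w) _

    -- Relax repeatedly from a realised labelling; the slack bounds the rounds.
    stabilise : ∀ fuel x → Realised x → slack x < fuel → Σ Labels λ y → ∀ v → relax y v ≡ y v
    stabilise zero       x realised ()
    stabilise (suc fuel) x realised bound with progress x realised
    ... | inj₁ stable  = x , stable
    ... | inj₂ lowered = stabilise fuel (relax x) (relax-realised x realised) (<-≤-trans lowered (≤-pred bound))

    stableLabels : Σ Labels λ y → ∀ v → relax y v ≡ y v
    stableLabels = stabilise (suc (slack (λ _ → 0))) (λ _ → 0) reach-zero ≤-refl

    label : Labels
    label = proj₁ stableLabels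

    demand-met : ∀ v u → demand label v u ≤ label v
    demand-met v u = subst (demand label v u ≤_) (proj₂ stableLabels v)
      (≤-trans (maxOver-ub (demand label v) u) (m≤n⊔m (label v) _))

    label-weak : ∀ {u v} → W u v ≡ true → label u ≤ label v
    label-weak {u} {v} weak =
      ≤-trans (subst (λ b → onlyIf b (label u) ≤ demand label v u) weak (m≤m⊔n _ _)) (demand-met v u)

    label-strict : ∀ {u v} → S u v ≡ true → label u < label v
    label-strict {u} {v} strict =
      ≤-trans (subst (λ b → onlyIf b (suc (label u)) ≤ demand label v u) strict (m≤n⊔m _ _)) (demand-met v u)

module AcyclicPotential where

  open import Data.Nat as ℕ using (ℕ; zero; suc)
  open import Data.Nat.Properties as ℕ using (m≤n⇒m<n∨m≡n)
  open import Data.Fin using (Fin)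
  open import Data.Bool using (Bool; true; false; _∨_; _∧_; not)
  open import Data.Bool.Properties using (∨-zeroʳ)
  open import Data.Rational using (ℚ; 0ℚ; 1ℚ; _+_; _<_; _<?_)
  open import Data.Rational.Properties using (+-identityˡ; +-monoˡ-<; <-trans)
  open import Data.Product using (Σ; _,_)
  open import Data.Sum using (inj₁; inj₂)
  open import Data.Unit using (tt)
  open import Function using (_∘_)
  open import Relation.Nullary.Decidable using (toWitness)
  open import Relation.Binary.PropositionalEquality using (_≡_; refl; trans; cong; cong₂; subst)
  open import Relation.Binary.Construct.Closure.ReflexiveTransitive using (ε; _◅_; _◅◅_)
  open Potentials using (Potential)
  open Walks
  open LongestWalks

  ℕ→ℚ : ℕ → ℚ
  ℕ→ℚ zero    = 0ℚ
  ℕ→ℚ (suc k) = 1ℚ + ℕ→ℚ k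

  ℕ→ℚ-suc : ∀ k → ℕ→ℚ k < ℕ→ℚ (suc k)
  ℕ→ℚ-suc k = subst (_< 1ℚ + ℕ→ℚ k) (+-identityˡ (ℕ→ℚ k)) (+-monoˡ-< (ℕ→ℚ k) (toWitness {a? = 0ℚ <? 1ℚ} tt))

  ℕ→ℚ-mono-< : ∀ {a b} → a ℕ.< b → ℕ→ℚ a < ℕ→ℚ b
  ℕ→ℚ-mono-< {a} {suc b} (ℕ.s≤s a≤b) with m≤n⇒m<n∨m≡n a≤b
  ... | inj₁ a<b  = <-trans (ℕ→ℚ-mono-< a<b) (ℕ→ℚ-suc b)
  ... | inj₂ refl = ℕ→ℚ-suc b

  module _ {n} (G H : Digraph n) (acyclic : CompAcyclic G H) where

    Reach : ℕ → Fin n → Set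
    Reach k v = Σ (Fin n) λ u → Walk (CompStep G H) k u v

    adjacentᵇ : Fin n → Fin n → Bool
    adjacentᵇ u v = H u v ∨ H v u

    leavingᵇ : Fin n → Fin n → Bool
    leavingᵇ u v = G u v ∧ not (H u v)

    adjacent : ∀ {u v} → adjacentᵇ u v ≡ true → UAdj H u v
    adjacent {u} {v} adj with H u v
    ... | true  = inj₁ refl
    ... | false = inj₂ adj

    leaving : ∀ {u v} → leavingᵇ u v ≡ true → OutEdge G H u v
    leaving {u} {v} lv with G u v | H u v
    leaving lv | true  | false = refl , refl
    leaving () | true  | true
    leaving () | false | _

    -- Moving within a component does not change the component reached.
    reach-adjacent : ∀ {k u v} → adjacentᵇ u v ≡ true → Reach k u → Reach k v
    reach-adjacent {v = v} adj (w , []) = v , []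
    reach-adjacent adj (w , p ▷ (a , b , x~a , out , b~u)) =
      w , p ▷ (a , b , x~a , out , b~u ◅◅ (adjacent adj ◅ ε))

    reach-leaving : ∀ {k u v} → leavingᵇ u v ≡ true → Reach k u → Reach (suc k) v
    reach-leaving {u = u} {v} lv (w , p) = w , p ▷ (u , v , ε , leaving lv , ε)

    reach-bounded : ∀ {k v} → Reach k v → k ℕ.≤ n
    reach-bounded (u , p) = ℕ.<⇒≤ (walk-shorter (λ v cycle → acyclic (v , cycle)) p)

    open Labelling adjacentᵇ leavingᵇ Reach n (λ v → v , []) reach-adjacent reach-leaving reach-bounded

    acyclic⇒potential : Potential G H
    acyclic⇒potential = record { level = ℕ→ℚ ∘ label ; flat = flat ; rising = rising }
      where
      flat : ∀ {a b} → H a b ≡ true → ℕ→ℚ (label a) ≡ ℕ→ℚ (label b)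
      flat {a} {b} ab∈H = cong ℕ→ℚ (ℕ.≤-antisym
        (label-weak (cong (_∨ H b a) ab∈H))
        (label-weak (trans (cong (H b a ∨_) ab∈H) (∨-zeroʳ (H b a)))))
      rising : ∀ {a b} → OutEdge G H a b → ℕ→ℚ (label a) < ℕ→ℚ (label b)
      rising (ab∈G , ab∉H) = ℕ→ℚ-mono-< (label-strict (cong₂ (λ g h → g ∧ not h) ab∈G ab∉H))

open import Data.Nat using (ℕ; _<_)
open import Data.Nat.Properties using (<-irrefl)
open import Data.Fin using (toℕ)
open import Data.Bool using (true)
open import Data.Product using (_×_; _,_)
open import Function.Bundles using (_⇔_; mk⇔)
open import Relation.Binary.PropositionalEquality using (_≡_; _≢_; cong)
open Potentials using (face⇒potential; potential⇒face; potential⇒loopless; potential⇒acyclic)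
open AcyclicPotential using (acyclic⇒potential)

theorem3p4 : (n : ℕ) (G H : Digraph n) →
    (∀ i j → G i j ≡ true → toℕ i < toℕ j) →
    H ⊆G G →
    IsFace (Q̃ H) (Q̃ G) ⇔ (CompLoopless G H × CompAcyclic G H)
theorem3p4 n G H ordered H⊆G = mk⇔ faceToComp compToFace
  where
  loopFree : ∀ {a b} → G a b ≡ true → a ≢ b
  loopFree {a} {b} ab∈G a≡b = <-irrefl (cong toℕ a≡b) (ordered a b ab∈G)

  faceToComp : IsFace (Q̃ H) (Q̃ G) → CompLoopless G H × CompAcyclic G H
  faceToComp face = potential⇒loopless P , potential⇒acyclic P
    where P = face⇒potential loopFree face

  compToFace : CompLoopless G H × CompAcyclic G H → IsFace (Q̃ H) (Q̃ G)
  compToFace (_ , acyclic) = potential⇒face H⊆G (acyclic⇒potential G H acyclic)
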